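{- Let $n,m\ge3$ be odd integers, $S$ and $T$ 2-partitions of $\mathbb{Z}_n^*$ and $\mathbb{Z}_m^*$ respectively, and $X_m$ a nucleus of order $m$. Then every $X$-generated product $W^X_{ST}$ is a 2-partition of $\mathbb{Z}_{mn}^*$.
   Context: $\mathbb{Z}_k^*=\mathbb{Z}_k\setminus\{0\}$; a 2-partition of $\mathbb{Z}_k^*$ is a partition into unordered pairs. A nucleus of order $m$ is a set of ordered pairs $X_m=\{(u_i,v_i)\}_{i=1}^{m-1}\subset\mathbb{Z}_m^*\times\mathbb{Z}_m^*$ such that $\{u_1,\dots,u_{m-1}\}=\{v_1,\dots,v_{m-1}\}=\mathbb{Z}_m^*$. $X$-generated product: with $n=2q+1$, $m=2p+1$, let $\tilde S$ (resp. $\tilde T$) be any set of ordered pairs obtained by ordering each pair of $S$ (resp. $T$) in either way. $W^X_{ST}$ consists of the unordered pairs $\{nr+x,\ nt+y\}$ (mod $nm$, with $x,y$ represented in $\{0,\dots,n-1\}$) of two types: (i$_X$) one pair for each $(x,y)\in\tilde S$ and each $(r,t)\in\{(0,0)\}\cup X_m$ ($mq$ pairs); (ii$_X$) one pair for each $(r,t)\in\tilde T$ with $x=y=0$ ($p$ pairs). -}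

module Defs where

open import Data.Nat using (ℕ; zero; suc; _+_; _*_; _∸_; _%_)
open import Data.Product using (_×_; _,_; proj₁; proj₂)
open import Data.List using (List; []; _∷_; map; upTo; concatMap; _++_; length)
open import Data.List.Relation.Binary.Permutation.Propositional using (_↭_)
open import Relation.Binary.PropositionalEquality using (_≡_)

-- Z_k^* = {1, …, k-1}, represented as the list [1, …, k-1] of naturals
-- (residues mod k are represented by their canonical representatives 0..k-1).
ℤ* : ℕ → List ℕ
ℤ* k = map suc (upTo (k ∸ 1))

elems : List (ℕ × ℕ) → List ℕ
elems = concatMap (λ pq → proj₁ pq ∷ proj₂ pq ∷ [])

-- Each unordered pair {a,b} is stored as an ordered pair (a , b) with an
-- arbitrary choice of orientation.
Is2Partition : ℕ → List (ℕ × ℕ) → Set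
Is2Partition k P = elems P ↭ ℤ* k

IsNucleus : ℕ → List (ℕ × ℕ) → Set
IsNucleus m X = (length X ≡ m ∸ 1) × (map proj₁ X ↭ ℤ* m) × (map proj₂ X ↭ ℤ* m)

-- reduction modulo k to the canonical representative (k > 0 in all uses)
_mod'_ : ℕ → ℕ → ℕ
a mod' zero = a
a mod' suc k = a % suc k

-- The X-generated product W^X_{ST}, where S̃ and T̃ are given as lists of
-- ordered pairs (the orientation of each pair being the chosen one).
--  (i_X)  {nr+x, nt+y} for (x,y) ∈ S̃ and (r,t) ∈ {(0,0)} ∪ X
--  (ii_X) {nr, nt}     for (r,t) ∈ T̃
W : (n m : ℕ) → (X S T : List (ℕ × ℕ)) → List (ℕ × ℕ)
W n m X S T =
  concatMap (λ xy → map (λ rt → ( (n * proj₁ rt + proj₁ xy) mod' (n * m)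
                                , (n * proj₂ rt + proj₂ xy) mod' (n * m)))
                        ((0 , 0) ∷ X)) S
  ++ map (λ rt → ((n * proj₁ rt) mod' (n * m) , (n * proj₂ rt) mod' (n * m))) T

-- Every entry of W is n r + x (mod nm) for some x < n and r < m, and we count the
-- multiset of entries, with 0 added. The pairs of type (i) built on a pair {x, y} of S
-- contribute the residue classes x + nℤ and y + nℤ of ℤ_{nm} exactly once each, because
-- the first (resp. second) coordinates of {(0,0)} ∪ X run once through ℤ_m. Since S
-- partitions ℤ_n^*, type (i) covers the classes of 1, …, n-1, and type (ii), together
-- with 0, covers the class of 0 since T partitions ℤ_m^*. The classes of all x < n
-- together are ℤ_{nm}.
module Submission where

open import Defs
open import Data.Nat using (ℕ; zero; suc; _+_; _*_; _%_; _≤_; _<_)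
open import Data.Nat.Properties
  using (*-suc; *-zeroʳ; *-comm; +-comm; +-assoc; +-identityʳ; +-monoʳ-<; *-monoʳ-≤; module ≤-Reasoning)
open import Data.Nat.DivMod using (m<n⇒m%n≡m)
open import Data.Product using (_×_; _,_; proj₁; proj₂)
open import Data.List using (List; []; _∷_; _++_; map; concat; concatMap; upTo; applyUpTo)
open import Data.List.Properties
  using (++-assoc; map-id; map-∘; map-cong; map-cong-local; map-applyUpTo;
         concatMap-cong; concatMap-++; concatMap-map; map-concatMap)
open import Data.List.Relation.Unary.All.Properties using (applyUpTo⁺₁)
open import Data.List.Relation.Binary.Permutation.Propositional as ↭
  using (_↭_; ↭-refl; ↭-prep; ↭-trans; ↭-sym; ↭-reflexive; module PermutationReasoning)
open import Data.List.Relation.Binary.Permutation.Propositional.Properties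
  using (map⁺; ++⁺; ++⁺ˡ; ++-comm; shift; shifts; drop-∷)
open import Relation.Binary.PropositionalEquality using (_≡_; refl; sym; cong; cong₂; trans; module ≡-Reasoning)
open import Function using (_∘_)

private
  variable
    A B C : Set

concatMap⁺ : (g : A → List B) {xs ys : List A} → xs ↭ ys → concatMap g xs ↭ concatMap g ys
concatMap⁺ g ↭.refl         = ↭-refl
concatMap⁺ g (↭.prep x p)   = ++⁺ˡ (g x) (concatMap⁺ g p)
concatMap⁺ g (↭.swap x y p) = ↭-trans (++⁺ˡ (g x) (++⁺ˡ (g y) (concatMap⁺ g p))) (shifts (g x) (g y))
concatMap⁺ g (↭.trans p q)  = ↭-trans (concatMap⁺ g p) (concatMap⁺ g q)

concatMap-∷-↭ : (f : A → B) (g : A → List B) (xs : List A) →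
                concatMap (λ a → f a ∷ g a) xs ↭ map f xs ++ concatMap g xs
concatMap-∷-↭ f g []       = ↭-refl
concatMap-∷-↭ f g (a ∷ xs) = ↭-prep (f a) (↭-trans (++⁺ˡ (g a) (concatMap-∷-↭ f g xs))
                                                  (shifts (g a) (map f xs)))

concatMap-[] : (xs : List A) → concatMap (λ _ → []) xs ≡ [] {A = B}
concatMap-[] []       = refl
concatMap-[] (_ ∷ xs) = concatMap-[] xs

concatMap-transpose : (f : A → B → C) (as : List A) (bs : List B) →
                      concatMap (λ a → map (f a) bs) as ↭ concatMap (λ b → map (λ a → f a b) as) bs
concatMap-transpose f []       bs = ↭-reflexive (sym (concatMap-[] bs))
concatMap-transpose f (a ∷ as) bs =
  ↭-trans (++⁺ˡ (map (f a) bs) (concatMap-transpose f as bs))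
          (↭-sym (concatMap-∷-↭ (f a) (λ b → map (λ a → f a b) as) bs))

applyUpTo-+ : (f : ℕ → A) (a b : ℕ) → applyUpTo f (a + b) ≡ applyUpTo f a ++ applyUpTo (f ∘ (a +_)) b
applyUpTo-+ f zero    b = refl
applyUpTo-+ f (suc a) b = cong (f 0 ∷_) (applyUpTo-+ (f ∘ suc) a b)

upTo-+ : (a b : ℕ) → upTo (a + b) ≡ upTo a ++ map (a +_) (upTo b)
upTo-+ a b = trans (applyUpTo-+ (λ i → i) a b) (cong (upTo a ++_) (sym (map-applyUpTo (λ i → i) (a +_) b)))

upTo-suc : (k : ℕ) → upTo (suc k) ≡ 0 ∷ ℤ* (suc k)
upTo-suc k = cong (0 ∷_) (sym (map-applyUpTo (λ i → i) suc k))

upTo-* : (n m : ℕ) → upTo (n * m) ≡ concatMap (λ r → map (n * r +_) (upTo n)) (upTo m)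
upTo-* n zero    = cong upTo (*-zeroʳ n)
upTo-* n (suc m) = begin
  upTo (n * suc m)                                 ≡⟨ cong upTo (*-suc n m) ⟩
  upTo (n + n * m)                                 ≡⟨ upTo-+ n (n * m) ⟩
  upTo n ++ map (n +_) (upTo (n * m))              ≡⟨ cong (λ l → upTo n ++ map (n +_) l) (upTo-* n m) ⟩
  upTo n ++ map (n +_) (concatMap row (upTo m))    ≡⟨ cong (upTo n ++_) (map-concatMap (n +_) row (upTo m)) ⟩
  upTo n ++ concatMap (map (n +_) ∘ row) (upTo m)  ≡⟨ cong₂ _++_ row-0 (concatMap-cong row-suc (upTo m)) ⟩
  row 0 ++ concatMap (row ∘ suc) (upTo m)          ≡⟨ cong (row 0 ++_) (concatMap-map row suc (upTo m)) ⟨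
  row 0 ++ concatMap row (map suc (upTo m))        ≡⟨ cong (λ l → row 0 ++ concatMap row l) (map-applyUpTo (λ i → i) suc m) ⟩
  concatMap row (upTo (suc m))                     ∎
  where
  open ≡-Reasoning
  row : ℕ → List ℕ
  row r = map (n * r +_) (upTo n)
  row-0 : upTo n ≡ row 0
  row-0 = sym (trans (map-cong (λ x → cong (_+ x) (*-zeroʳ n)) (upTo n)) (map-id (upTo n)))
  row-suc : ∀ r → map (n +_) (row r) ≡ row (suc r)
  row-suc r = trans (sym (map-∘ (upTo n)))
                    (map-cong (λ x → trans (sym (+-assoc n (n * r) x)) (cong (_+ x) (sym (*-suc n r)))) (upTo n))

map-cong-upTo : {f g : ℕ → A} (k : ℕ) → (∀ {i} → i < k → f i ≡ g i) → map f (upTo k) ≡ map g (upTo k)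
map-cong-upTo {f = f} {g} k f≡g = map-cong-local (applyUpTo⁺₁ {P = λ i → f i ≡ g i} (λ i → i) k f≡g)

mod'-< : ∀ {a N} → a < N → a mod' N ≡ a
mod'-< {N = suc N} a<N = m<n⇒m%n≡m a<N

*+-< : ∀ n {m r x} → r < m → x < n → n * r + x < n * m
*+-< n {m} {r} {x} r<m x<n = begin-strict
  n * r + x  <⟨ +-monoʳ-< (n * r) x<n ⟩
  n * r + n  ≡⟨ +-comm (n * r) n ⟩
  n + n * r  ≡⟨ *-suc n r ⟨
  n * suc r  ≤⟨ *-monoʳ-≤ n r<m ⟩
  n * m      ∎
  where open ≤-Reasoning

elems-++ : (ps qs : List (ℕ × ℕ)) → elems (ps ++ qs) ≡ elems ps ++ elems qs
elems-++ = concatMap-++ _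

elems-map : (h : A → ℕ × ℕ) (xs : List A) → elems (map h xs) ↭ map (proj₁ ∘ h) xs ++ map (proj₂ ∘ h) xs
elems-map h []       = ↭-refl
elems-map h (a ∷ xs) =
  ↭-prep _ (↭-trans (↭-prep _ (elems-map h xs)) (↭-sym (shift _ (map (proj₁ ∘ h) xs) _)))

elems-map-diagonal : (f : ℕ → ℕ) (ps : List (ℕ × ℕ)) →
                     elems (map (λ p → (f (proj₁ p) , f (proj₂ p))) ps) ≡ map f (elems ps)
elems-map-diagonal f ps = trans (concatMap-map _ _ ps) (sym (map-concatMap f _ ps))

elems-concatMap : (h : A → List (ℕ × ℕ)) (k : A → List ℕ) → (∀ a → elems (h a) ↭ k a) →
                  (xs : List A) → elems (concatMap h xs) ↭ concatMap k xs
elems-concatMap h k h↭k []       = ↭-refl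
elems-concatMap h k h↭k (a ∷ xs) =
  ↭-trans (↭-reflexive (elems-++ (h a) (concatMap h xs))) (++⁺ (h↭k a) (elems-concatMap h k h↭k xs))

concatMap-elems : (g : ℕ → List A) (ps : List (ℕ × ℕ)) →
                  concatMap (λ p → g (proj₁ p) ++ g (proj₂ p)) ps ≡ concatMap g (elems ps)
concatMap-elems g []             = refl
concatMap-elems g ((x , y) ∷ ps) =
  trans (++-assoc (g x) (g y) _) (cong (λ l → g x ++ g y ++ l) (concatMap-elems g ps))

module ResidueClasses (n′ m′ : ℕ) where

  n m N : ℕ
  n = suc n′
  m = suc m′
  N = n * m

  residue : ℕ → ℕ → ℕ
  residue x r = (n * r + x) mod' N

  residueClass : ℕ → List ℕ
  residueClass x = map (residue x) (upTo m)

  -- W n m X S T unfolds to Wᵢ X S ++ Wᵢᵢ T, the pairs of type (i) and (ii).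
  Wᵢ-block : (X : List (ℕ × ℕ)) → ℕ × ℕ → List (ℕ × ℕ)
  Wᵢ-block X xy = map (λ rt → (residue (proj₁ xy) (proj₁ rt) , residue (proj₂ xy) (proj₂ rt))) ((0 , 0) ∷ X)

  Wᵢ : (X S : List (ℕ × ℕ)) → List (ℕ × ℕ)
  Wᵢ X S = concatMap (Wᵢ-block X) S

  Wᵢᵢ : (T : List (ℕ × ℕ)) → List (ℕ × ℕ)
  Wᵢᵢ T = map (λ rt → ((n * proj₁ rt) mod' N , (n * proj₂ rt) mod' N)) T

  residueClasses-↭-upTo : concatMap residueClass (upTo n) ↭ upTo N
  residueClasses-↭-upTo = begin
    concatMap (λ x → map (residue x) (upTo m)) (upTo n)     ↭⟨ concatMap-transpose residue (upTo n) (upTo m) ⟩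
    concatMap (λ r → map (λ x → residue x r) (upTo n)) (upTo m)
      ≡⟨ cong concat (map-cong-upTo m λ r<m → map-cong-upTo n λ x<n → mod'-< (*+-< n r<m x<n)) ⟩
    concatMap (λ r → map (n * r +_) (upTo n)) (upTo m)       ≡⟨ upTo-* n m ⟨
    upTo N                                                  ∎
    where open PermutationReasoning

  map-residue-↭ : (x : ℕ) {us : List ℕ} → us ↭ ℤ* m → map (residue x) (0 ∷ us) ↭ residueClass x
  map-residue-↭ x us↭ℤ* = map⁺ (residue x) (↭-trans (↭-prep 0 us↭ℤ*) (↭-reflexive (sym (upTo-suc m′))))

  elems-Wᵢ-block : (X : List (ℕ × ℕ)) → map proj₁ X ↭ ℤ* m → map proj₂ X ↭ ℤ* m →
                   (xy : ℕ × ℕ) → elems (Wᵢ-block X xy) ↭ residueClass (proj₁ xy) ++ residueClass (proj₂ xy)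
  elems-Wᵢ-block X X₁↭ℤ* X₂↭ℤ* (x , y) = ↭-trans (elems-map _ ((0 , 0) ∷ X))
    (++⁺ (↭-trans (↭-reflexive (map-∘ ((0 , 0) ∷ X))) (map-residue-↭ x X₁↭ℤ*))
         (↭-trans (↭-reflexive (map-∘ ((0 , 0) ∷ X))) (map-residue-↭ y X₂↭ℤ*)))

  elems-Wᵢ : (X S : List (ℕ × ℕ)) → map proj₁ X ↭ ℤ* m → map proj₂ X ↭ ℤ* m → elems S ↭ ℤ* n →
             elems (Wᵢ X S) ↭ concatMap residueClass (ℤ* n)
  elems-Wᵢ X S X₁↭ℤ* X₂↭ℤ* S↭ℤ* = begin
    elems (Wᵢ X S)
      ↭⟨ elems-concatMap (Wᵢ-block X) _ (elems-Wᵢ-block X X₁↭ℤ* X₂↭ℤ*) S ⟩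
    concatMap (λ xy → residueClass (proj₁ xy) ++ residueClass (proj₂ xy)) S
      ≡⟨ concatMap-elems residueClass S ⟩
    concatMap residueClass (elems S)
      ↭⟨ concatMap⁺ residueClass S↭ℤ* ⟩
    concatMap residueClass (ℤ* n)
      ∎
    where open PermutationReasoning

  elems-Wᵢᵢ : (T : List (ℕ × ℕ)) → elems T ↭ ℤ* m → 0 ∷ elems (Wᵢᵢ T) ↭ residueClass 0
  elems-Wᵢᵢ T T↭ℤ* = begin
    0 ∷ elems (Wᵢᵢ T)                        ≡⟨ cong (0 ∷_) (elems-map-diagonal (λ a → (n * a) mod' N) T) ⟩
    0 ∷ map (λ a → (n * a) mod' N) (elems T) ≡⟨ cong₂ _∷_ residue-0-0 (map-cong residue-0 (elems T)) ⟩
    map (residue 0) (0 ∷ elems T)            ↭⟨ map-residue-↭ 0 T↭ℤ* ⟩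
    residueClass 0                           ∎
    where
    open PermutationReasoning
    residue-0 : ∀ r → (n * r) mod' N ≡ residue 0 r
    residue-0 r = cong (_mod' N) (sym (+-identityʳ (n * r)))
    residue-0-0 : 0 ≡ residue 0 0
    residue-0-0 = trans (cong (_mod' N) (sym (*-zeroʳ n))) (residue-0 0)

theorem3p15 : (n m : ℕ) → 3 ≤ n → n % 2 ≡ 1 → 3 ≤ m → m % 2 ≡ 1 →
    (S T X : List (ℕ × ℕ)) →
    Is2Partition n S → Is2Partition m T → IsNucleus m X →
    Is2Partition (m * n) (W n m X S T)
theorem3p15 (suc n′) (suc m′) _ _ _ _ S T X S↭ℤ* T↭ℤ* (_ , X₁↭ℤ* , X₂↭ℤ*) = drop-∷ (begin
  0 ∷ elems (Wᵢ X S ++ Wᵢᵢ T)                      ≡⟨ cong (0 ∷_) (elems-++ (Wᵢ X S) (Wᵢᵢ T)) ⟩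
  0 ∷ elems (Wᵢ X S) ++ elems (Wᵢᵢ T)              ↭⟨ shift 0 (elems (Wᵢ X S)) (elems (Wᵢᵢ T)) ⟨
  elems (Wᵢ X S) ++ 0 ∷ elems (Wᵢᵢ T)              ↭⟨ ++⁺ (elems-Wᵢ X S X₁↭ℤ* X₂↭ℤ* S↭ℤ*) (elems-Wᵢᵢ T T↭ℤ*) ⟩
  concatMap residueClass (ℤ* n) ++ residueClass 0  ↭⟨ ++-comm (concatMap residueClass (ℤ* n)) (residueClass 0) ⟩
  concatMap residueClass (0 ∷ ℤ* n)                ≡⟨ cong (concatMap residueClass) (upTo-suc n′) ⟨
  concatMap residueClass (upTo n)                  ↭⟨ residueClasses-↭-upTo ⟩
  upTo (n * m)                                     ≡⟨ cong upTo (*-comm n m) ⟩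
  upTo (m * n)                                     ≡⟨ upTo-suc _ ⟩
  0 ∷ ℤ* (m * n)                                   ∎)
  where
  open ResidueClasses n′ m′
  open PermutationReasoning
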